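{- Let $\mathbf{L}$ be a dually ms Stone semi-Heyting algebra and $x\in L$. Then $x' \vee ((x^*)')^{**} = 1$.
   Context: A semi-Heyting algebra is an algebra $\langle L,\vee,\wedge,\to,0,1\rangle$ such that $\langle L,\vee,\wedge,0,1\rangle$ is a bounded lattice and the identities $x\wedge(x\to y)\approx x\wedge y$, $x\wedge(y\to z)\approx x\wedge[(x\wedge y)\to(x\wedge z)]$, and $x\to x\approx 1$ hold; $x^* := x\to 0$ is the pseudocomplement. A dually quasi-De Morgan semi-Heyting algebra is an algebra $\langle L,\vee,\wedge,\to,{}',0,1\rangle$ whose reduct $\langle L,\vee,\wedge,\to,0,1\rangle$ is a semi-Heyting algebra and which satisfies $0'\approx 1$, $1'\approx 0$, $(x\wedge y)'\approx x'\vee y'$, $(x\vee y)''\approx x''\vee y''$, and $x''\le x$. A dually ms Stone semi-Heyting algebra is a dually quasi-De Morgan semi-Heyting algebra that additionally satisfies $(x\vee y)'\approx x'\wedge y'$ and the Stone identity $x^*\vee x^{**}\approx 1$. -}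

module Defs where

open import Level using (Level; suc; _⊔_)
open import Relation.Binary.PropositionalEquality using (_≡_)
open import Algebra.Lattice.Structures using (IsLattice)

record DmsStoneSH (c : Level) : Set (suc c) where
  infixr 5 _→'_
  infixr 6 _∨_
  infixr 7 _∧_
  infix 4 _≤_
  infixl 9 _′ _*
  field
    Carrier : Set c
    _∨_ _∧_ _→'_ : Carrier → Carrier → Carrier
    _′ : Carrier → Carrier
    𝟘 𝟙 : Carrier

  _≤_ : Carrier → Carrier → Set c
  x ≤ y = x ∧ y ≡ x

  _* : Carrier → Carrier
  x * = x →' 𝟘

  field
    isLattice : IsLattice _≡_ _∨_ _∧_
    𝟘-least : ∀ x → 𝟘 ∧ x ≡ 𝟘
    𝟙-greatest : ∀ x → x ∧ 𝟙 ≡ x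
    sh1 : ∀ x y → x ∧ (x →' y) ≡ x ∧ y
    sh2 : ∀ x y z → x ∧ (y →' z) ≡ x ∧ ((x ∧ y) →' (x ∧ z))
    sh3 : ∀ x → x →' x ≡ 𝟙
    dq1 : 𝟘 ′ ≡ 𝟙
    dq2 : 𝟙 ′ ≡ 𝟘
    dq3 : ∀ x y → (x ∧ y) ′ ≡ x ′ ∨ y ′
    dq4 : ∀ x y → (x ∨ y) ′ ′ ≡ x ′ ′ ∨ y ′ ′
    dq5 : ∀ x → x ′ ′ ≤ x
    dms : ∀ x y → (x ∨ y) ′ ≡ x ′ ∧ y ′
    stone : ∀ x → x * ∨ x * * ≡ 𝟙

module Submission where

-- Write a = x*′.  Since x ∧ x* = 0, the dual De Morgan law
-- (x ∧ y)′ = x′ ∨ y′ together with 0′ = 1 gives x′ ∨ a = 1.  In any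
-- semi-Heyting algebra every element lies below its double pseudocomplement,
-- so a ≤ a**.  Finally, in a bounded lattice the set of elements whose join
-- with x′ is 1 is closed upwards, hence x′ ∨ a** = 1.

open import Defs
open import Level using (Level)
open import Relation.Binary.PropositionalEquality
  using (_≡_; sym; trans; cong; module ≡-Reasoning)
open import Algebra.Lattice.Structures using (IsLattice)

module Properties {c : Level} (L : DmsStoneSH c) where
  open DmsStoneSH L
  open IsLattice isLattice using (∨-comm; ∨-assoc; ∧-comm; ∨-absorbs-∧)
  open ≡-Reasoning

  ∧-zeroʳ : ∀ y → y ∧ 𝟘 ≡ 𝟘
  ∧-zeroʳ y = trans (∧-comm y 𝟘) (𝟘-least y)

  ∨-oneˡ : ∀ y → 𝟙 ∨ y ≡ 𝟙
  ∨-oneˡ y = begin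
    𝟙 ∨ y        ≡⟨ cong (𝟙 ∨_) (sym (trans (∧-comm 𝟙 y) (𝟙-greatest y))) ⟩
    𝟙 ∨ (𝟙 ∧ y)  ≡⟨ ∨-absorbs-∧ 𝟙 y ⟩
    𝟙            ∎

  ≤⇒∨≡ : ∀ {y z} → y ≤ z → y ∨ z ≡ z
  ≤⇒∨≡ {y} {z} y≤z = begin
    y ∨ z        ≡⟨ cong (_∨ z) (sym y≤z) ⟩
    (y ∧ z) ∨ z  ≡⟨ ∨-comm (y ∧ z) z ⟩
    z ∨ (y ∧ z)  ≡⟨ cong (z ∨_) (∧-comm y z) ⟩
    z ∨ (z ∧ y)  ≡⟨ ∨-absorbs-∧ z y ⟩
    z            ∎

  ∨-one-upward : ∀ {w y z} → w ∨ y ≡ 𝟙 → y ≤ z → w ∨ z ≡ 𝟙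
  ∨-one-upward {w} {y} {z} w∨y≡1 y≤z = begin
    w ∨ z        ≡⟨ cong (w ∨_) (sym (≤⇒∨≡ y≤z)) ⟩
    w ∨ (y ∨ z)  ≡⟨ sym (∨-assoc w y z) ⟩
    (w ∨ y) ∨ z  ≡⟨ cong (_∨ z) w∨y≡1 ⟩
    𝟙 ∨ z        ≡⟨ ∨-oneˡ z ⟩
    𝟙            ∎

  ∧-pseudocomplement : ∀ y → y ∧ y * ≡ 𝟘
  ∧-pseudocomplement y = trans (sh1 y 𝟘) (∧-zeroʳ y)

  ≤-double-pseudocomplement : ∀ y → y ≤ y * *
  ≤-double-pseudocomplement y = begin
    y ∧ (y * →' 𝟘)             ≡⟨ sh2 y (y *) 𝟘 ⟩
    y ∧ ((y ∧ y *) →' (y ∧ 𝟘)) ≡⟨ cong (λ t → y ∧ (t →' (y ∧ 𝟘))) (∧-pseudocomplement y) ⟩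
    y ∧ (𝟘 →' (y ∧ 𝟘))         ≡⟨ cong (λ t → y ∧ (𝟘 →' t)) (∧-zeroʳ y) ⟩
    y ∧ (𝟘 →' 𝟘)               ≡⟨ cong (y ∧_) (sh3 𝟘) ⟩
    y ∧ 𝟙                      ≡⟨ 𝟙-greatest y ⟩
    y                          ∎

  dual-∨-dual-pseudocomplement : ∀ y → y ′ ∨ y * ′ ≡ 𝟙
  dual-∨-dual-pseudocomplement y = begin
    y ′ ∨ y * ′    ≡⟨ sym (dq3 y (y *)) ⟩
    (y ∧ y *) ′    ≡⟨ cong _′ (∧-pseudocomplement y) ⟩
    𝟘 ′            ≡⟨ dq1 ⟩
    𝟙              ∎

lemma4p2 : ∀ {c : Level} (L : DmsStoneSH c) → let open DmsStoneSH L in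
           ∀ (x : Carrier) → x ′ ∨ x * ′ * * ≡ 𝟙
lemma4p2 L x =
  ∨-one-upward (dual-∨-dual-pseudocomplement x)
               (≤-double-pseudocomplement (x * ′))
  where open DmsStoneSH L
        open Properties L
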